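{- Let $H$ be a reflexive digraph and $H^*$ its implication graph. For two distinct vertices $u,v$ of $H$, the pair $u,v$ is an invertible pair of $H$ if and only if the vertices $(u,v)$ and $(v,u)$ of $H^*$ lie in the same strong component of $H^*$.
   Context: Digraphs are finite, without multiple edges, possibly with loops; a digraph is reflexive if every vertex has a loop. The pair digraph $H^+$ of a digraph $H$ has vertex set $\{(u,v) : u,v \in V(H),\ u \neq v\}$, and for vertices $u,u',v,v'$ of $H$ we have edges $(u,u') \to (v,v')$ and $(v',v) \to (u',u)$ in $H^+$ if and only if $(u,v),(u',v') \in E(H)$ and $(u,v') \notin E(H)$. An invertible pair of $H$ is a pair of vertices $u,v$ such that $(u,v)$ and $(v,u)$ are in the same strong component of $H^+$. The implication graph $H^*$ of a reflexive digraph $H$ has vertex set $\{(u,v) : u \neq v\}$, and for any three distinct vertices $u,v,w$ of $H$ we have edges $(u,v) \to (w,v)$ and $(v,w) \to (v,u)$ in $H^*$ if and only if either ($(u,w) \in E(H)$ and $(u,v) \notin E(H)$) or ($(w,u) \in E(H)$ and $(v,u) \notin E(H)$). -}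

module Defs where

open import Data.Nat using (ℕ)
open import Data.Fin using (Fin)
open import Data.Bool using (Bool; true)
open import Data.Product using (Σ; _×_; _,_)
open import Data.Sum using (_⊎_)
open import Relation.Binary.PropositionalEquality using (_≡_; _≢_)
open import Relation.Nullary using (¬_)
open import Relation.Binary.Construct.Closure.ReflexiveTransitive using (Star)

record Digraph : Set where
  field
    n   : ℕ
    adj : Fin n → Fin n → Bool

open Digraph public

Vertex : Digraph → Set
Vertex H = Fin (n H)

Edge : (H : Digraph) → Vertex H → Vertex H → Set
Edge H u v = adj H u v ≡ true

IsReflexive : Digraph → Set
IsReflexive H = ∀ u → Edge H u u

-- ordered pairs of vertices of H (vertices of H⁺ / H* are those with distinct components)
Pair : Digraph → Set
Pair H = Vertex H × Vertex H

PairEdge : (H : Digraph) → Pair H → Pair H → Set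
PairEdge H p q =
  Σ (Vertex H) λ u → Σ (Vertex H) λ u' → Σ (Vertex H) λ v → Σ (Vertex H) λ v' →
    u ≢ u' × v ≢ v' ×
    Edge H u v × Edge H u' v' × ¬ Edge H u v' ×
    ((p ≡ (u , u') × q ≡ (v , v')) ⊎ (p ≡ (v' , v) × q ≡ (u' , u)))

ImplEdge : (H : Digraph) → Pair H → Pair H → Set
ImplEdge H p q =
  Σ (Vertex H) λ u → Σ (Vertex H) λ v → Σ (Vertex H) λ w →
    u ≢ v × u ≢ w × v ≢ w ×
    ((Edge H u w × ¬ Edge H u v) ⊎ (Edge H w u × ¬ Edge H v u)) ×
    ((p ≡ (u , v) × q ≡ (w , v)) ⊎ (p ≡ (v , w) × q ≡ (v , u)))

SameStrongComponent : {A : Set} → (A → A → Set) → A → A → Set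
SameStrongComponent R x y = Star R x y × Star R y x

InvertiblePair : (H : Digraph) → Vertex H → Vertex H → Set
InvertiblePair H u v = SameStrongComponent (PairEdge H) (u , v) (v , u)

module Submission where

-- For a reflexive digraph H, the implication graph H* and the pair digraph H⁺
-- have the same vertex set and the same reachability relation, so in particular
-- the same strong components.
--
--   * every edge of H* is an edge of H⁺: the H*-edge coming from a vertex w
--     with (u,w) ∈ E (or (w,u) ∈ E) is the H⁺-edge built from that edge
--     together with the loop at v;
--   * every edge (a,a') → (b,b') of H⁺ (and its reversed twin) is a walk of
--     length at most two in H*: first the second coordinate moves along the
--     edge (a',b'), then the first coordinate moves along (a,b).  The
--     non-edge (a,b') supplies the required non-adjacency in both steps.

open import Defs
open import Data.Product using (_,_; _×_; proj₁; proj₂)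
open import Data.Sum using (_⊎_; inj₁; inj₂; swap)
open import Data.Fin using (_≟_)
open import Function.Bundles using (_⇔_; mk⇔)
open import Relation.Nullary using (¬_; yes; no)
open import Relation.Binary.PropositionalEquality using (_≡_; _≢_; ≢-sym; refl)
open import Relation.Binary.Construct.Closure.ReflexiveTransitive
  using (Star; ε; _◅_; _◅◅_; _⋆)

sameComponent-transfer : {A : Set} {R S : A → A → Set} →
  (∀ {x y} → R x y → Star S x y) →
  ∀ {x y} → SameStrongComponent R x y → SameStrongComponent S x y
sameComponent-transfer simulate (there , back) = (simulate ⋆) there , (simulate ⋆) back

module _ (H : Digraph) (reflexive : IsReflexive H) where

  nonEdge⇒distinct : ∀ {x y} → ¬ Edge H x y → x ≢ y
  nonEdge⇒distinct ¬xy refl = ¬xy (reflexive _)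

  -- An H*-edge (u,v) → (w,v) (resp. (v,w) → (v,u)) is the H⁺-edge
  -- (u,v) → (w,v) (resp. its twin) obtained from an edge between u and w
  -- and the loop at v; when the edge is (w,u), the roles of the two twin
  -- H⁺-edges are exchanged.
  implEdge⇒pairEdge : ∀ {p q} → ImplEdge H p q → PairEdge H p q
  implEdge⇒pairEdge (u , v , w , u≢v , _ , v≢w , inj₁ (uw , ¬uv) , orientation) =
    u , v , w , v , u≢v , ≢-sym v≢w , uw , reflexive v , ¬uv , orientation
  implEdge⇒pairEdge (u , v , w , _ , _ , v≢w , inj₂ (wu , ¬vu) , orientation) =
    v , w , v , u , v≢w , nonEdge⇒distinct ¬vu , reflexive v , wu , ¬vu , swap orientation

  -- The two H*-moves licensed by a vertex w, allowing the degenerate case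
  -- w = u, where the move is the empty walk.
  implMoves : ∀ {u v w} → u ≢ v → v ≢ w →
    (Edge H u w × ¬ Edge H u v) ⊎ (Edge H w u × ¬ Edge H v u) →
    Star (ImplEdge H) (u , v) (w , v) × Star (ImplEdge H) (v , w) (v , u)
  implMoves {u} {v} {w} u≢v v≢w condition with u ≟ w
  ... | yes refl = ε , ε
  ... | no u≢w =
    (u , v , w , u≢v , u≢w , v≢w , condition , inj₁ (refl , refl)) ◅ ε ,
    (u , v , w , u≢v , u≢w , v≢w , condition , inj₂ (refl , refl)) ◅ ε

  -- Every H⁺-edge is an H*-walk: move the second coordinate along (a',b'),
  -- then the first along (a,b); for the twin edge the same moves are taken
  -- in the reversed roles.
  pairEdge⇒implWalk : ∀ {p q} → PairEdge H p q → Star (ImplEdge H) p q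
  pairEdge⇒implWalk {p} {q} (a , a' , b , b' , a≢a' , b≢b' , ab , a'b' , ¬ab' , orientation) =
    follow orientation
    where
    a≢b' : a ≢ b'
    a≢b' = nonEdge⇒distinct ¬ab'
    secondMove : Star (ImplEdge H) (b' , a) (a' , a) × Star (ImplEdge H) (a , a') (a , b')
    secondMove = implMoves (≢-sym a≢b') a≢a' (inj₂ (a'b' , ¬ab'))
    firstMove : Star (ImplEdge H) (a , b') (b , b') × Star (ImplEdge H) (b' , b) (b' , a)
    firstMove = implMoves a≢b' (≢-sym b≢b') (inj₁ (ab , ¬ab'))
    follow : (p ≡ (a , a') × q ≡ (b , b')) ⊎ (p ≡ (b' , b) × q ≡ (a' , a)) →
             Star (ImplEdge H) p q
    follow (inj₁ (refl , refl)) = proj₂ secondMove ◅◅ proj₁ firstMove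
    follow (inj₂ (refl , refl)) = proj₂ firstMove ◅◅ proj₁ secondMove

lemma1 : (H : Digraph) → IsReflexive H → (u v : Vertex H) → u ≢ v →
         InvertiblePair H u v ⇔ SameStrongComponent (ImplEdge H) (u , v) (v , u)
lemma1 H reflexive u v _ = mk⇔
  (sameComponent-transfer (pairEdge⇒implWalk H reflexive))
  (sameComponent-transfer (λ e → implEdge⇒pairEdge H reflexive e ◅ ε))
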